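{- For every $m\geq 1$ there is a bijection between the set of involutions $\pi\in I(321)_{2m}$ with $\pi(1)\neq 1$ and the set of involutions $\pi\in I(321)_{2m}$ with $\pi(1)=1$.
   Context: A permutation of length $n$ is a bijection of $\{1,\dots,n\}$. A permutation avoids $321$ if it has no indices $i<j<k$ with $\pi(i)>\pi(j)>\pi(k)$. An involution satisfies $\pi(\pi(i))=i$ for all $i$. $I(321)_n$ is the set of involutions of length $n$ avoiding $321$. -}

module Defs where

open import Data.Nat using (ℕ; suc; _*_)
open import Data.Fin using (Fin; zero; _<_)
open import Data.Product using (Σ; _×_; proj₁)
open import Relation.Nullary using (¬_)
open import Relation.Binary.PropositionalEquality using (_≡_)
import Relation.Binary.PropositionalEquality
open import Relation.Binary.Bundles using (Setoid)
open import Function.Bundles using (Bijection)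
open import Level using (0ℓ)

-- A map π : [n] → [n] is an involution when π ∘ π = id
-- (such a map is automatically a bijection, i.e. a permutation).
IsInvolution : {n : ℕ} → (Fin n → Fin n) → Set
IsInvolution π = ∀ i → π (π i) ≡ i

Avoids321 : {n : ℕ} → (Fin n → Fin n) → Set
Avoids321 π = ∀ i j k → i < j → j < k → ¬ (π j < π i × π k < π j)

I321Setoid : (n : ℕ) → ((Fin n → Fin n) → Set) → Setoid 0ℓ 0ℓ
I321Setoid n P = record
  { Carrier = Σ (Fin n → Fin n) (λ π → IsInvolution π × Avoids321 π × P π)
  ; _≈_ = λ x y → ∀ i → proj₁ x i ≡ proj₁ y i
  ; isEquivalence = record
    { refl = λ i → Relation.Binary.PropositionalEquality.refl
    ; sym = λ p i → Relation.Binary.PropositionalEquality.sym (p i)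
    ; trans = λ p q i → Relation.Binary.PropositionalEquality.trans (p i) (q i)
    }
  }

-- { π ∈ I(321)_{n+1} : π(1) ≠ 1 }  (position 1 is Fin index zero)
I321-moves1 : ℕ → Setoid 0ℓ 0ℓ
I321-moves1 n = I321Setoid (suc n) (λ π → ¬ (π zero ≡ zero))

I321-fixes1 : ℕ → Setoid 0ℓ 0ℓ
I321-fixes1 n = I321Setoid (suc n) (λ π → π zero ≡ zero)

module Submission where

-- A 321-avoiding involution π of [N] is determined by its
-- word: the letter at position i is U if i < π i (i opens an arc),
-- D if π i < i (i closes an arc) and F if π i = i.  Avoiding 321 forces
-- the arcs to be matched first-in-first-out, so the word is a Motzkin
-- path all of whose flat steps lie at height 0, and conversely every
-- such path is the word of exactly one 321-avoiding involution.
-- On paths of even length N the bijection is explicit: a path U w is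
-- sent to F w', where w' arises from w by flattening the first step that
-- returns to height 0; the inverse turns F w into U w'', changing the
-- first flat step of w (which exists because w has odd length) into D.

open import Defs
open import Data.Nat using (ℕ; _*_; _∸_; _≥_)
open import Function.Bundles using (Bijection)

open import Data.Nat using (zero; suc; _+_; _<_; _≤_; z≤n; s≤s; pred; s≤s⁻¹)
open import Data.Nat.Properties
open import Data.Nat.Induction using (<-rec)
open import Data.Fin using (Fin; toℕ; fromℕ<) renaming (zero to fzero)
open import Data.Fin.Properties using (toℕ-injective; toℕ<n; fromℕ<-toℕ; toℕ-fromℕ<)
open import Data.Product using (Σ; _×_; _,_; proj₁; proj₂)
open import Data.Sum using (inj₁; inj₂)
open import Data.Empty using (⊥; ⊥-elim)
open import Relation.Nullary using (¬_; yes; no)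
open import Relation.Binary.PropositionalEquality
open import Relation.Binary using (Tri; tri<; tri≈; tri>)
open import Relation.Binary.Bundles using (Setoid)
open import Function using (_∘_)
open import Function.Bundles using (Inverse)
open import Function.Properties.Inverse using (Inverse⇒Bijection)

-- The three kinds of position of an involution: arc opener, arc closer,
-- fixed point; as path steps: up, down, flat.
data Letter : Set where
  U D F : Letter

letter : ℕ → ℕ → Letter
letter zero    zero    = F
letter zero    (suc _) = U
letter (suc _) zero    = D
letter (suc i) (suc x) = letter i x

letter-F : ∀ i x → letter i x ≡ F → x ≡ i
letter-F zero    zero    _ = refl
letter-F (suc i) (suc x) e = cong suc (letter-F i x e)

letter-U : ∀ i x → letter i x ≡ U → i < x
letter-U zero    (suc x) _ = s≤s z≤n
letter-U (suc i) (suc x) e = s≤s (letter-U i x e)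

letter-D : ∀ i x → letter i x ≡ D → x < i
letter-D (suc i) zero    _ = s≤s z≤n
letter-D (suc i) (suc x) e = s≤s (letter-D i x e)

letter-≡ : ∀ i → letter i i ≡ F
letter-≡ zero    = refl
letter-≡ (suc i) = letter-≡ i

letter-< : ∀ i x → i < x → letter i x ≡ U
letter-< zero    (suc x) _       = refl
letter-< (suc i) (suc x) (s≤s p) = letter-< i x p

letter-> : ∀ i x → x < i → letter i x ≡ D
letter-> (suc i) zero    _       = refl
letter-> (suc i) (suc x) (s≤s p) = letter-> i x p

-- Letters only depend on the relative order of i and x, so they are
-- invariant under strictly increasing relabelling.
letter-embed : (e : ℕ → ℕ) → (∀ {a b} → a < b → e a < e b) →
               ∀ i x → letter (e i) (e x) ≡ letter i x
letter-embed e mono i x with <-cmp i x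
... | tri< i<x _ _    = trans (letter-< _ _ (mono i<x)) (sym (letter-< _ _ i<x))
... | tri≈ _ refl _   = trans (letter-≡ (e i)) (sym (letter-≡ i))
... | tri> _ _ x<i    = trans (letter-> _ _ (mono x<i)) (sym (letter-> _ _ x<i))

-- Words are infinite letter sequences of which only a prefix matters.
Word : Set
Word = ℕ → Letter

infixr 5 _◂_
_◂_ : Letter → Word → Word
(x ◂ w) zero    = x
(x ◂ w) (suc i) = w i

◂-head-tail : ∀ w i → (w 0 ◂ (w ∘ suc)) i ≡ w i
◂-head-tail w zero    = refl
◂-head-tail w (suc i) = refl

_≈[_]_ : Word → ℕ → Word → Set
w ≈[ n ] w' = ∀ i → i < n → w i ≡ w' i

≈-tail : ∀ {n w w'} → w ≈[ suc n ] w' → (w ∘ suc) ≈[ n ] (w' ∘ suc)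
≈-tail E i p = E (suc i) (s≤s p)

-- Path h n w: the first n letters of w, read from height h, form a path
-- that never goes below 0, takes flat steps only at height 0 and ends at
-- height 0.  PathAfter h x n w is the same for the word x ◂ w.
mutual
  Path : ℕ → ℕ → Word → Set
  Path h zero    w = h ≡ 0
  Path h (suc n) w = PathAfter h (w 0) n (w ∘ suc)

  PathAfter : ℕ → Letter → ℕ → Word → Set
  PathAfter h       F n w = h ≡ 0 × Path 0 n w
  PathAfter h       U n w = Path (suc h) n w
  PathAfter zero    D n w = ⊥
  PathAfter (suc h) D n w = Path h n w

Path-cong : ∀ h n w w' → w ≈[ n ] w' → Path h n w → Path h n w'
Path-cong h zero w w' E p = p
Path-cong h (suc n) w w' E p with w 0 | w' 0 | E 0 (s≤s z≤n)
... | F | .F | refl = proj₁ p , Path-cong 0 n _ _ (≈-tail E) (proj₂ p)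
... | U | .U | refl = Path-cong (suc h) n _ _ (≈-tail E) p
Path-cong zero    (suc n) w w' E () | D | .D | refl
Path-cong (suc h) (suc n) w w' E p  | D | .D | refl = Path-cong h n _ _ (≈-tail E) p

Path-uncons : ∀ h n w x → w 0 ≡ x → Path h (suc n) w → PathAfter h x n (w ∘ suc)
Path-uncons h n w x e p = subst (λ y → PathAfter h y n (w ∘ suc)) e p

Path-cons : ∀ h n w x → w 0 ≡ x → PathAfter h x n (w ∘ suc) → Path h (suc n) w
Path-cons h n w x e p = subst (λ y → PathAfter h y n (w ∘ suc)) (sym e) p

Path-drop-ups : ∀ k h m w → (∀ j → j < k → w j ≡ U) →
                Path h (k + m) w → Path (h + k) m (λ i → w (k + i))
Path-drop-ups zero h m w ups p = subst (λ x → Path x m w) (sym (+-identityʳ h)) p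
Path-drop-ups (suc k) h m w ups p =
  subst (λ x → Path x m (λ i → w (suc k + i))) (sym (+-suc h k))
    (Path-drop-ups k (suc h) m (w ∘ suc) (λ j q → ups (suc j) (s≤s q))
      (Path-uncons h (k + m) w U (ups 0 (s≤s z≤n)) p))

Path-add-ups : ∀ k h m w → (∀ j → j < k → w j ≡ U) →
               Path (h + k) m (λ i → w (k + i)) → Path h (k + m) w
Path-add-ups zero h m w ups p = subst (λ x → Path x m w) (+-identityʳ h) p
Path-add-ups (suc k) h m w ups p =
  Path-cons h (k + m) w U (ups 0 (s≤s z≤n))
    (Path-add-ups k (suc h) m (w ∘ suc) (λ j q → ups (suc j) (s≤s q))
      (subst (λ x → Path x m (λ i → w (suc k + i))) (+-suc h k) p))

mutual
  closeFlat : ℕ → Word → Word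
  closeFlat zero    w = w
  closeFlat (suc n) w = closeFlatAfter (w 0) n (w ∘ suc)

  closeFlatAfter : Letter → ℕ → Word → Word
  closeFlatAfter F n w = D ◂ w
  closeFlatAfter U n w = U ◂ closeFlat n w
  closeFlatAfter D n w = D ◂ closeFlat n w

mutual
  flattenReturn : ℕ → ℕ → Word → Word
  flattenReturn h zero    w = w
  flattenReturn h (suc n) w = flattenReturnAfter h (w 0) n (w ∘ suc)

  flattenReturnAfter : ℕ → Letter → ℕ → Word → Word
  flattenReturnAfter h             U n w = U ◂ flattenReturn (suc h) n w
  flattenReturnAfter h             F n w = F ◂ w
  flattenReturnAfter zero          D n w = D ◂ w
  flattenReturnAfter (suc zero)    D n w = F ◂ w
  flattenReturnAfter (suc (suc h)) D n w = D ◂ flattenReturn (suc h) n w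

mutual
  closeFlat-cong : ∀ n w w' → w ≈[ n ] w' → closeFlat n w ≈[ n ] closeFlat n w'
  closeFlat-cong (suc n) w w' E i p with w 0 | w' 0 | E 0 (s≤s z≤n)
  ... | x | .x | refl = closeFlatAfter-cong x n _ _ (≈-tail E) i p

  closeFlatAfter-cong : ∀ x n w w' → w ≈[ n ] w' →
                        closeFlatAfter x n w ≈[ suc n ] closeFlatAfter x n w'
  closeFlatAfter-cong F n w w' E zero    _       = refl
  closeFlatAfter-cong U n w w' E zero    _       = refl
  closeFlatAfter-cong D n w w' E zero    _       = refl
  closeFlatAfter-cong F n w w' E (suc i) (s≤s p) = E i p
  closeFlatAfter-cong U n w w' E (suc i) (s≤s p) = closeFlat-cong n w w' E i p
  closeFlatAfter-cong D n w w' E (suc i) (s≤s p) = closeFlat-cong n w w' E i p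

mutual
  flattenReturn-cong : ∀ h n w w' → w ≈[ n ] w' →
                       flattenReturn h n w ≈[ n ] flattenReturn h n w'
  flattenReturn-cong h (suc n) w w' E i p with w 0 | w' 0 | E 0 (s≤s z≤n)
  ... | x | .x | refl = flattenReturnAfter-cong h x n _ _ (≈-tail E) i p

  flattenReturnAfter-cong : ∀ h x n w w' → w ≈[ n ] w' →
                            flattenReturnAfter h x n w ≈[ suc n ] flattenReturnAfter h x n w'
  flattenReturnAfter-cong h x n w w' E zero _ with x | h
  ... | U | _             = refl
  ... | F | _             = refl
  ... | D | zero          = refl
  ... | D | suc zero      = refl
  ... | D | suc (suc _)   = refl
  flattenReturnAfter-cong h             U n w w' E (suc i) (s≤s p) = flattenReturn-cong (suc h) n w w' E i p
  flattenReturnAfter-cong h             F n w w' E (suc i) (s≤s p) = E i p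
  flattenReturnAfter-cong zero          D n w w' E (suc i) (s≤s p) = E i p
  flattenReturnAfter-cong (suc zero)    D n w w' E (suc i) (s≤s p) = E i p
  flattenReturnAfter-cong (suc (suc h)) D n w w' E (suc i) (s≤s p) = flattenReturn-cong (suc h) n w w' E i p

-- Odd numbers, and the two parity steps used when a path letter is read
-- (height and remaining length change by ±1 each).
data Odd : ℕ → Set where
  one     : Odd 1
  plusTwo : ∀ {n} → Odd n → Odd (suc (suc n))

Odd-shift : ∀ a b → Odd (suc a + b) → Odd (a + suc b)
Odd-shift a b o = subst Odd (sym (+-suc a b)) o

Odd-pred₂ : ∀ a b → Odd (suc a + suc b) → Odd (a + b)
Odd-pred₂ a b o with subst Odd (cong suc (+-suc a b)) o
... | plusTwo o' = o'

-- If n + h is odd, a path of length n from height h cannot consist of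
-- up and down steps only; closing its first flat step (which is at height
-- 0) yields a path from height h + 1.
mutual
  closeFlat-Path : ∀ n h w → Path h n w → Odd (n + h) → Path (suc h) n (closeFlat n w)
  closeFlat-Path zero    h w refl ()
  closeFlat-Path (suc n) h w p o = closeFlatAfter-Path (w 0) n h (w ∘ suc) p o

  closeFlatAfter-Path : ∀ x n h w → PathAfter h x n w → Odd (suc n + h) →
                        Path (suc h) (suc n) (closeFlatAfter x n w)
  closeFlatAfter-Path F n .zero w (refl , p) o = p
  closeFlatAfter-Path U n h w p o = closeFlat-Path n (suc h) w p (Odd-shift n h o)
  closeFlatAfter-Path D n (suc h) w p o = closeFlat-Path n h w p (Odd-pred₂ n h o)

-- A path from height h + 1 reaches height 0 by a down step; flattening
-- the first such step gives a path from height h.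
mutual
  flattenReturn-Path : ∀ n h w → Path (suc h) n w → Path h n (flattenReturn (suc h) n w)
  flattenReturn-Path (suc n) h w p = flattenReturnAfter-Path (w 0) n h (w ∘ suc) p

  flattenReturnAfter-Path : ∀ x n h w → PathAfter (suc h) x n w →
                            Path h (suc n) (flattenReturnAfter (suc h) x n w)
  flattenReturnAfter-Path U n h       w p = flattenReturn-Path n (suc h) w p
  flattenReturnAfter-Path F n h       w (() , _)
  flattenReturnAfter-Path D n zero    w p = refl , p
  flattenReturnAfter-Path D n (suc h) w p = flattenReturn-Path n h w p

mutual
  flattenReturn-closeFlat : ∀ n h w → Path h n w → Odd (n + h) →
                            flattenReturn (suc h) n (closeFlat n w) ≈[ n ] w
  flattenReturn-closeFlat zero    h w refl ()
  flattenReturn-closeFlat (suc n) h w p o i q =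
    trans (flattenReturnAfter-closeFlatAfter (w 0) n h (w ∘ suc) p o i q) (◂-head-tail w i)

  flattenReturnAfter-closeFlatAfter :
    ∀ x n h w → PathAfter h x n w → Odd (suc n + h) →
    flattenReturn (suc h) (suc n) (closeFlatAfter x n w) ≈[ suc n ] (x ◂ w)
  flattenReturnAfter-closeFlatAfter F n .zero w (refl , p) o zero    _ = refl
  flattenReturnAfter-closeFlatAfter F n .zero w (refl , p) o (suc i) _ = refl
  flattenReturnAfter-closeFlatAfter U n h w p o zero _ = refl
  flattenReturnAfter-closeFlatAfter U n h w p o (suc i) (s≤s q) =
    flattenReturn-closeFlat n (suc h) w p (Odd-shift n h o) i q
  flattenReturnAfter-closeFlatAfter D n (suc h) w p o zero _ = refl
  flattenReturnAfter-closeFlatAfter D n (suc h) w p o (suc i) (s≤s q) =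
    flattenReturn-closeFlat n h w p (Odd-pred₂ n h o) i q

mutual
  closeFlat-flattenReturn : ∀ n h w → Path (suc h) n w →
                            closeFlat n (flattenReturn (suc h) n w) ≈[ n ] w
  closeFlat-flattenReturn (suc n) h w p i q =
    trans (closeFlatAfter-flattenReturnAfter (w 0) n h (w ∘ suc) p i q) (◂-head-tail w i)

  closeFlatAfter-flattenReturnAfter :
    ∀ x n h w → PathAfter (suc h) x n w →
    closeFlat (suc n) (flattenReturnAfter (suc h) x n w) ≈[ suc n ] (x ◂ w)
  closeFlatAfter-flattenReturnAfter U n h w p zero _ = refl
  closeFlatAfter-flattenReturnAfter U n h w p (suc i) (s≤s q) = closeFlat-flattenReturn n (suc h) w p i q
  closeFlatAfter-flattenReturnAfter F n h w (() , _)
  closeFlatAfter-flattenReturnAfter D n zero    w p zero    _ = refl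
  closeFlatAfter-flattenReturnAfter D n zero    w p (suc i) _ = refl
  closeFlatAfter-flattenReturnAfter D n (suc h) w p zero    _ = refl
  closeFlatAfter-flattenReturnAfter D n (suc h) w p (suc i) (s≤s q) = closeFlat-flattenReturn n h w p i q

-- 321-avoiding involutions of {0, …, n-1}, represented by functions on ℕ
-- (only their values below n matter); this avoids Fin arithmetic while
-- positions are inserted and removed.
record Inv321 (n : ℕ) (g : ℕ → ℕ) : Set where
  field
    bounded    : ∀ i → i < n → g i < n
    involutive : ∀ i → i < n → g (g i) ≡ i
    avoids     : ∀ i j k → i < j → j < k → k < n → g j < g i → g k < g j → ⊥
open Inv321

code : (ℕ → ℕ) → Word
code g i = letter i (g i)

Inv321-injective : ∀ {n g} → Inv321 n g → ∀ x y → x < n → y < n → g x ≡ g y → x ≡ y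
Inv321-injective {g = g} G x y x<n y<n e =
  trans (sym (involutive G x x<n)) (trans (cong g e) (involutive G y y<n))

-- Arcs do not nest: if u₁ < u₂ and u₂ opens an arc, its partner exceeds
-- that of u₁ (else u₁, u₂, g u₂ would form a 321).
arcs-nonnesting : ∀ {n g} → Inv321 n g → ∀ u₁ u₂ → u₁ < u₂ → u₂ < n →
                  u₂ < g u₂ → g u₂ < g u₁ → ⊥
arcs-nonnesting {g = g} G u₁ u₂ u₁<u₂ u₂<n opens nested =
  avoids G u₁ u₂ (g u₂) u₁<u₂ opens (bounded G u₂ u₂<n) nested
    (subst (_< g u₂) (sym (involutive G u₂ u₂<n)) opens)

-- Two involutions with the same word, agreeing below an opener i, give i
-- the same partner: if g i < h i, then d = g i closes an arc in h too, and
-- its opener u = h d can be neither below i (g would not be injective),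
-- nor i itself, nor above i (the arc (i, h i) would nest the arc (u, d)).
opener-partner : ∀ {n g h} → Inv321 n g → Inv321 n h → code g ≈[ n ] code h →
                 ∀ i → i < n → (∀ j → j < i → j < n → g j ≡ h j) →
                 i < g i → i < h i → g i < h i → ⊥
opener-partner {n} {g} {h} G H E i i<n below i<gi i<hi gi<hi = compare (<-cmp u i)
  where
  d : ℕ
  d = g i
  d<n : d < n
  d<n = bounded G i i<n
  hd<d : h d < d
  hd<d = letter-D d (h d)
    (trans (sym (E d d<n)) (trans (cong (letter d) (involutive G i i<n)) (letter-> d i i<gi)))
  u : ℕ
  u = h d
  u<n : u < n
  u<n = bounded H d d<n
  hu : h u ≡ d
  hu = involutive H d d<n
  compare : Tri (u < i) (u ≡ i) (i < u) → ⊥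
  compare (tri< u<i _ _) =
    <-irrefl (Inv321-injective G u i u<n i<n (trans (below u u<i u<n) hu)) u<i
  compare (tri≈ _ u≡i _) = <-irrefl (trans (sym hu) (cong h u≡i)) gi<hi
  compare (tri> _ _ i<u) =
    arcs-nonnesting H i u i<u u<n (subst (u <_) (sym hu) hd<d) (subst (_< h i) (sym hu) gi<hi)

-- The word determines the involution, by strong induction on i: the
-- letters F and D determine g i directly (for D by the induction
-- hypothesis at g i < i), and for U use opener-partner in both directions.
code-injective : ∀ {n g h} → Inv321 n g → Inv321 n h → code g ≈[ n ] code h →
                 ∀ i → i < n → g i ≡ h i
code-injective {n} {g} {h} G H E = <-rec (λ i → i < n → g i ≡ h i) step
  where
  step : ∀ i → (∀ {j} → j < i → j < n → g j ≡ h j) → i < n → g i ≡ h i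
  step i below i<n with letter i (g i) in eq
  ... | F = trans (letter-F i (g i) eq) (sym (letter-F i (h i) (trans (sym (E i i<n)) eq)))
  ... | D = begin
      g i             ≡⟨ sym (involutive H (g i) gi<n) ⟩
      h (h (g i))     ≡⟨ cong h (sym (below (letter-D i (g i) eq) gi<n)) ⟩
      h (g (g i))     ≡⟨ cong h (involutive G i i<n) ⟩
      h i             ∎
    where
    open ≡-Reasoning
    gi<n : g i < n
    gi<n = bounded G i i<n
  ... | U with <-cmp (g i) (h i)
  ...   | tri≈ _ e _  = e
  ...   | tri< lt _ _ = ⊥-elim (opener-partner G H E i i<n (λ j p q → below p q)
                          (letter-U i (g i) eq) (letter-U i (h i) (trans (sym (E i i<n)) eq)) lt)
  ...   | tri> _ _ gt = ⊥-elim (opener-partner H G (λ j p → sym (E j p)) i i<n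
                          (λ j p q → sym (below p q))
                          (letter-U i (h i) (trans (sym (E i i<n)) eq)) (letter-U i (g i) eq) gt)

≤-mono⇒reflects-< : (f : ℕ → ℕ) → (∀ {a b} → a ≤ b → f a ≤ f b) → ∀ {a b} → f a < f b → a < b
≤-mono⇒reflects-< f mono fa<fb = ≰⇒> (λ b≤a → <⇒≱ fa<fb (mono b≤a))

<-mono⇒≤-mono : (f : ℕ → ℕ) → (∀ {a b} → a < b → f a < f b) → ∀ {a b} → a ≤ b → f a ≤ f b
<-mono⇒≤-mono f mono a≤b with m≤n⇒m<n∨m≡n a≤b
... | inj₁ a<b  = <⇒≤ (mono a<b)
... | inj₂ refl = ≤-refl

-- Restriction of an involution to a set of positions closed under it:
-- the set is the image of an increasing map e with left inverse c, and
-- g' = c ∘ g ∘ e is again a 321-avoiding involution whose word is the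
-- word of g read along e.
module Restrict {n g} (G : Inv321 n g) (n' : ℕ) (e c : ℕ → ℕ)
  (e-mono  : ∀ {a b} → a < b → e a < e b)
  (c-mono  : ∀ {a b} → a ≤ b → c a ≤ c b)
  (e-bound : ∀ i → i < n' → e i < n)
  (c∘e     : ∀ i → c (e i) ≡ i)
  (closed  : ∀ i → i < n' → e (c (g (e i))) ≡ g (e i))
  (c-bound : ∀ i → i < n' → c (g (e i)) < n') where

  g' : ℕ → ℕ
  g' i = c (g (e i))

  restricted : Inv321 n' g'
  bounded restricted = c-bound
  involutive restricted i i<n' = begin
      c (g (e (c (g (e i)))))  ≡⟨ cong (c ∘ g) (closed i i<n') ⟩
      c (g (g (e i)))          ≡⟨ cong c (involutive G (e i) (e-bound i i<n')) ⟩
      c (e i)                  ≡⟨ c∘e i ⟩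
      i                        ∎
    where open ≡-Reasoning
  avoids restricted i j k i<j j<k k<n' s t =
    avoids G (e i) (e j) (e k) (e-mono i<j) (e-mono j<k) (e-bound k k<n') (reflect s) (reflect t)
    where reflect = ≤-mono⇒reflects-< c c-mono

  code-restricted : ∀ i → i < n' → code g' i ≡ code g (e i)
  code-restricted i i<n' =
    trans (sym (letter-embed e e-mono i (g' i))) (cong (letter (e i)) (closed i i<n'))

-- skip b enumerates ℕ without b; unskip b is its inverse.
skip : ℕ → ℕ → ℕ
skip zero    i       = suc i
skip (suc b) zero    = zero
skip (suc b) (suc i) = suc (skip b i)

unskip : ℕ → ℕ → ℕ
unskip zero    x       = pred x
unskip (suc b) zero    = zero
unskip (suc b) (suc x) = suc (unskip b x)

skip-mono : ∀ b {i j} → i < j → skip b i < skip b j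
skip-mono zero    p                         = s≤s p
skip-mono (suc b) {zero}  {suc j} _         = s≤s z≤n
skip-mono (suc b) {suc i} {suc j} (s≤s p)   = s≤s (skip-mono b p)

unskip-mono : ∀ b {x y} → x ≤ y → unskip b x ≤ unskip b y
unskip-mono zero    p                       = pred-mono-≤ p
unskip-mono (suc b) {zero}  _               = z≤n
unskip-mono (suc b) {suc x} {suc y} (s≤s p) = s≤s (unskip-mono b p)

unskip-skip : ∀ b i → unskip b (skip b i) ≡ i
unskip-skip zero    i       = refl
unskip-skip (suc b) zero    = refl
unskip-skip (suc b) (suc i) = cong suc (unskip-skip b i)

skip-unskip : ∀ b x → x ≢ b → skip b (unskip b x) ≡ x
skip-unskip zero    zero    ne = ⊥-elim (ne refl)
skip-unskip zero    (suc x) _  = refl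
skip-unskip (suc b) zero    _  = refl
skip-unskip (suc b) (suc x) ne = cong suc (skip-unskip b x (ne ∘ cong suc))

skip-≢ : ∀ b i → skip b i ≢ b
skip-≢ (suc b) (suc i) e = skip-≢ b i (suc-injective e)

skip-< : ∀ b i → i < b → skip b i ≡ i
skip-< (suc b) zero    _       = refl
skip-< (suc b) (suc i) (s≤s p) = cong suc (skip-< b i p)

skip-≥ : ∀ b i → b ≤ i → skip b i ≡ suc i
skip-≥ zero    i       _       = refl
skip-≥ (suc b) (suc i) (s≤s p) = cong suc (skip-≥ b i p)

skip-≤ : ∀ b i → skip b i ≤ suc i
skip-≤ zero    i       = ≤-refl
skip-≤ (suc b) zero    = z≤n
skip-≤ (suc b) (suc i) = s≤s (skip-≤ b i)

skip-below : ∀ b i → skip b i < b → i < b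
skip-below b i p with <-cmp i b
... | tri< i<b _ _ = i<b
... | tri≈ _ refl _ = ⊥-elim (<⇒≱ p (subst (b ≤_) (sym (skip-≥ b i ≤-refl)) (n≤1+n b)))
... | tri> _ _ b<i  =
  ⊥-elim (<⇒≱ p (subst (b ≤_) (sym (skip-≥ b i (<⇒≤ b<i))) (≤-trans (<⇒≤ b<i) (n≤1+n i))))

unskip-bound : ∀ b m x → x < suc m → x ≢ b → b ≤ m → unskip b x < m
unskip-bound zero    m       zero    _       ne _       = ⊥-elim (ne refl)
unskip-bound zero    m       (suc x) (s≤s p) _  _       = p
unskip-bound (suc b) (suc m) zero    _       _  _       = s≤s z≤n
unskip-bound (suc b) (suc m) (suc x) (s≤s p) ne (s≤s q) = s≤s (unskip-bound b m x p (ne ∘ cong suc) q)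

-- Positions other than 0 and b + 1, and the inverse enumeration.
outside : ℕ → ℕ → ℕ
outside b i = suc (skip b i)

inside : ℕ → ℕ → ℕ
inside b j = unskip b (pred j)

outside-mono : ∀ b {x y} → x < y → outside b x < outside b y
outside-mono b p = s≤s (skip-mono b p)

outside-bound : ∀ b r i → i < b + r → outside b i < suc (suc (b + r))
outside-bound b r i p = s≤s (≤-trans (s≤s (skip-≤ b i)) (s≤s p))

suc-pred≢0 : ∀ x → x ≢ 0 → suc (pred x) ≡ x
suc-pred≢0 zero    ne = ⊥-elim (ne refl)
suc-pred≢0 (suc x) _  = refl

pred-bound : ∀ x m → x < suc m → x ≢ 0 → pred x < m
pred-bound zero    m _       ne = ⊥-elim (ne refl)
pred-bound (suc x) m (s≤s p) _  = p

module RemoveFixed {n g} (G : Inv321 (suc n) g) (g0 : g 0 ≡ 0) where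
  nonzero : ∀ i → i < n → g (suc i) ≢ 0
  nonzero i p e = 0≢1+n (Inv321-injective G 0 (suc i) (s≤s z≤n) (s≤s p) (trans g0 (sym e)))

  open Restrict G n suc pred s≤s pred-mono-≤ (λ i → s≤s) (λ i → refl)
    (λ i p → suc-pred≢0 (g (suc i)) (nonzero i p))
    (λ i p → pred-bound (g (suc i)) n (bounded G (suc i) (s≤s p)) (nonzero i p)) public

module RemoveArc {b r g} (G : Inv321 (suc (suc (b + r))) g) (g0 : g 0 ≡ suc b) where
  N : ℕ
  N = suc (suc (b + r))

  g-partner : g (suc b) ≡ 0
  g-partner = trans (cong g (sym g0)) (involutive G 0 (s≤s z≤n))

  partner<N : suc b < N
  partner<N = s≤s (s≤s (m≤m+n b r))

  nonzero : ∀ i → i < b + r → g (outside b i) ≢ 0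
  nonzero i p e = skip-≢ b i (suc-injective
    (Inv321-injective G (outside b i) (suc b) (outside-bound b r i p) partner<N (trans e (sym g-partner))))

  not-partner : ∀ i → i < b + r → pred (g (outside b i)) ≢ b
  not-partner i p e = 0≢1+n (sym (Inv321-injective G (outside b i) 0 (outside-bound b r i p) (s≤s z≤n)
    (trans (sym (suc-pred≢0 _ (nonzero i p))) (trans (cong suc e) (sym g0)))))

  open Restrict G (b + r) (outside b) (inside b) (outside-mono b)
    (λ p → unskip-mono b (pred-mono-≤ p)) (outside-bound b r)
    (unskip-skip b)
    (λ i p → trans (cong suc (skip-unskip b _ (not-partner i p))) (suc-pred≢0 _ (nonzero i p)))
    (λ i p → unskip-bound b (b + r) _
       (pred-bound _ (suc (b + r)) (bounded G (outside b i) (outside-bound b r i p)) (nonzero i p))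
       (not-partner i p) (m≤m+n b r)) public

  -- Every position j strictly inside the arc (0, b + 1) is an opener: a
  -- fixed point would be nested in the arc, and a closer would close an
  -- arc nested in it.
  inner-opens : ∀ j → 0 < j → j < suc b → code g j ≡ U
  inner-opens j 0<j j<a with <-cmp (g j) j
  ... | tri< gj<j _ _ = ⊥-elim (closes (g j) refl gj<j)
    where
    j<N : j < N
    j<N = ≤-trans j<a (s≤s (≤-trans (m≤m+n b r) (n≤1+n _)))
    closes : ∀ u → g j ≡ u → u < j → ⊥
    closes zero    e _   = <-irrefl (trans (sym (involutive G j j<N)) (trans (cong g e) g0)) j<a
    closes (suc u) e u<j = arcs-nonnesting G 0 (suc u) (s≤s z≤n) (<-trans u<j j<N)
      (subst (suc u <_) (trans (sym (involutive G j j<N)) (cong g e)) u<j)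
      (subst (_< g 0) (trans (sym (involutive G j j<N)) (cong g e)) (subst (j <_) (sym g0) j<a))
  ... | tri≈ _ fixed _ = ⊥-elim (avoids G 0 j (suc b) 0<j j<a partner<N
          (subst (_< g 0) (sym fixed) (subst (j <_) (sym g0) j<a))
          (subst (_< g j) (sym g-partner) (subst (0 <_) (sym fixed) 0<j)))
  ... | tri> _ _ j<gj = letter-< j (g j) j<gj

-- Removing the arc
-- (0, b + 1) leaves an involution of length b + r whose word is, by
-- induction, a path; the word of g after position 0 is then b up steps
-- (the positions inside the arc), the down step at b + 1, and the
-- remaining letters, which form a path from height b.
code-Path-arc : ∀ {n} b r g → suc (b + r) ≡ n → Inv321 (suc n) g → g 0 ≡ suc b →
                (∀ g' → Inv321 (b + r) g' → Path 0 (b + r) (code g')) →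
                Path 1 n (code g ∘ suc)
code-Path-arc b r g refl G g0 induction =
  subst (λ x → Path 1 x w) (+-suc b r)
    (Path-add-ups b 1 (suc r) w inner
      (Path-cons (suc b) r (λ i → w (b + i)) D closer
        (Path-cong b r _ _ rest-matches
          (Path-drop-ups b 0 r (code g') inner' (induction g' restricted)))))
  where
  open RemoveArc G g0
  w : Word
  w = code g ∘ suc

  inner : ∀ j → j < b → w j ≡ U
  inner j p = inner-opens (suc j) (s≤s z≤n) (s≤s p)

  inner' : ∀ j → j < b → code g' j ≡ U
  inner' j p = trans (code-restricted j (<-≤-trans p (m≤m+n b r)))
                     (trans (cong w (skip-< b j p)) (inner j p))

  closer : w (b + 0) ≡ D
  closer = trans (cong w (+-identityʳ b)) (cong (letter (suc b)) g-partner)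

  rest-matches : ∀ i → i < r → code g' (b + i) ≡ w (b + suc i)
  rest-matches i p = trans (code-restricted (b + i) (+-monoʳ-< b p))
    (cong w (trans (skip-≥ b (b + i) (m≤m+n b i)) (sym (+-suc b i))))

code-Path : ∀ n g → Inv321 n g → Path 0 n (code g)
code-Path = <-rec (λ n → ∀ g → Inv321 n g → Path 0 n (code g)) step
  where
  step : ∀ n → (∀ {m} → m < n → ∀ g → Inv321 m g → Path 0 m (code g)) →
         ∀ g → Inv321 n g → Path 0 n (code g)
  step zero    _         g G = refl
  step (suc n) induction g G with g 0 in g0
  ... | zero  = refl , Path-cong 0 n _ _ code-restricted (induction ≤-refl g' restricted)
    where open RemoveFixed G g0
  ... | suc b = code-Path-arc b (n ∸ suc b) g split G g0
                  (induction (s≤s (≤-trans (n≤1+n _) (≤-reflexive split))))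
    where
    split : suc (b + (n ∸ suc b)) ≡ n
    split = m+[n∸m]≡n (s≤s⁻¹ (subst (_< suc n) g0 (bounded G 0 (s≤s z≤n))))

first-down : ∀ h n w → Path (suc h) n w →
             Σ ℕ λ a → a < n × w a ≡ D × (∀ j → j < a → w j ≡ U)
first-down h (suc n) w p = after (w 0) refl (Path-uncons (suc h) n w (w 0) refl p)
  where
  after : ∀ x → w 0 ≡ x → PathAfter (suc h) x n (w ∘ suc) →
          Σ ℕ λ a → a < suc n × w a ≡ D × (∀ j → j < a → w j ≡ U)
  after F _  (() , _)
  after D e  _ = 0 , s≤s z≤n , e , λ j ()
  after U e  p' with first-down (suc h) n (w ∘ suc) p'
  ... | a , a<n , down , ups = suc a , s≤s a<n , down , λ { zero _ → e ; (suc j) (s≤s q) → ups j q }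

Realised : ℕ → Word → Set
Realised n w = Σ (ℕ → ℕ) λ g → Inv321 n g × code g ≈[ n ] w

empty-Inv321 : Inv321 0 (λ i → i)
bounded    empty-Inv321 i ()
involutive empty-Inv321 i ()
avoids     empty-Inv321 i j k _ _ () _ _

addFixed : (ℕ → ℕ) → ℕ → ℕ
addFixed g zero    = zero
addFixed g (suc i) = suc (g i)

addFixed-Inv321 : ∀ n g → Inv321 n g → Inv321 (suc n) (addFixed g)
bounded    (addFixed-Inv321 n g G) zero    _       = s≤s z≤n
bounded    (addFixed-Inv321 n g G) (suc i) (s≤s p) = s≤s (bounded G i p)
involutive (addFixed-Inv321 n g G) zero    _       = refl
involutive (addFixed-Inv321 n g G) (suc i) (s≤s p) = cong suc (involutive G i p)
avoids     (addFixed-Inv321 n g G) zero (suc j) k _ _ _ () _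
avoids     (addFixed-Inv321 n g G) (suc i) (suc j) (suc k) (s≤s p) (s≤s q) (s≤s r) (s≤s s) (s≤s t) =
  avoids G i j k p q r s t

-- Adding an arc (0, b + 1), the old positions moving to outside b.
addArc : ℕ → (ℕ → ℕ) → ℕ → ℕ
addArc b g zero = suc b
addArc b g (suc x) with x ≟ b
... | yes _ = 0
... | no _  = outside b (g (unskip b x))

addArc-partner : ∀ b g → addArc b g (suc b) ≡ 0
addArc-partner b g with b ≟ b
... | yes _ = refl
... | no ne = ⊥-elim (ne refl)

addArc-outside : ∀ b g i → addArc b g (outside b i) ≡ outside b (g i)
addArc-outside b g i with skip b i ≟ b
... | yes e = ⊥-elim (skip-≢ b i e)
... | no _  = cong (outside b ∘ g) (unskip-skip b i)

outside-reflects : ∀ b {x y} → outside b x < outside b y → x < y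
outside-reflects b = ≤-mono⇒reflects-< (outside b) (<-mono⇒≤-mono (outside b) (outside-mono b))

outside-below : ∀ b {y} → outside b y < suc b → y < b
outside-below b (s≤s p) = skip-below b _ p

-- Adding the arc (0, b + 1) to a 321-avoiding involution g' of length
-- b + r whose first b positions are openers gives a 321-avoiding
-- involution of length b + r + 2: the new arc can only take part in a
-- 321 together with arcs nested in it, which the openers exclude.
module AddArc (b r : ℕ) (g' : ℕ → ℕ) (G' : Inv321 (b + r) g')
              (opens : ∀ x → x < b → x < g' x) where
  N : ℕ
  N = suc (suc (b + r))

  g : ℕ → ℕ
  g = addArc b g'

  data Position : ℕ → Set where
    first   : Position 0
    partner : Position (suc b)
    old     : ∀ y → y < b + r → Position (outside b y)

  position : ∀ j → j < N → Position j
  position zero    _ = first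
  position (suc x) (s≤s p) with x ≟ b
  ... | yes refl = partner
  ... | no ne    = subst Position (cong suc (skip-unskip b x ne))
                     (old (unskip b x) (unskip-bound b (b + r) x p ne (m≤m+n b r)))

  closes : ∀ y → y < b + r → g' y < b → g' y < y
  closes y y<n inside = subst (g' y <_) (involutive G' y y<n) (opens (g' y) inside)

  partner-inside : ∀ y → g (outside b y) < suc b → g' y < b
  partner-inside y p = outside-below b (subst (_< suc b) (addArc-outside b g' y) p)

  old-reflects : ∀ y z → g (outside b y) < g (outside b z) → g' y < g' z
  old-reflects y z p = outside-reflects b (subst₂ _<_ (addArc-outside b g' y) (addArc-outside b g' z) p)

  added : Inv321 N g
  bounded added j p with position j p
  ... | first    = s≤s (s≤s (m≤m+n b r))
  ... | partner  = subst (_< N) (sym (addArc-partner b g')) (s≤s z≤n)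
  ... | old y q  = subst (_< N) (sym (addArc-outside b g' y)) (outside-bound b r (g' y) (bounded G' y q))
  involutive added j p with position j p
  ... | first    = addArc-partner b g'
  ... | partner  = cong g (addArc-partner b g')
  ... | old y q  = trans (cong g (addArc-outside b g' y))
                     (trans (addArc-outside b g' (g' y)) (cong (outside b) (involutive G' y q)))
  avoids added i j k i<j j<k k<N s t
    with position i (<-trans i<j (<-trans j<k k<N)) | position j (<-trans j<k k<N) | position k k<N
  ... | first   | first   | _       = <-irrefl refl i<j
  ... | first   | partner | _       = n≮0 (subst (g k <_) (addArc-partner b g') t)
  ... | first   | old y _ | first   = n≮0 j<k
  ... | first   | old y q | partner =
    <-irrefl refl (<-trans (opens y (outside-below b j<k)) (closes y q (partner-inside y s)))
  ... | first   | old y q | old z q' =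
    arcs-nonnesting G' (g' z) (g' y) (old-reflects z y t) (bounded G' y q)
      (opens (g' y) (partner-inside y s))
      (subst₂ _<_ (sym (involutive G' y q)) (sym (involutive G' z q')) (outside-reflects b j<k))
  ... | partner | _       | _       = n≮0 (subst (g j <_) (addArc-partner b g') s)
  ... | old _ _ | first   | _       = n≮0 i<j
  ... | old _ _ | partner | _       = n≮0 (subst (g k <_) (addArc-partner b g') t)
  ... | old _ _ | old _ _ | first   = n≮0 j<k
  ... | old x _ | old y q | partner =
    arcs-nonnesting G' x y (outside-reflects b i<j) q (opens y (outside-below b j<k)) (old-reflects y x s)
  ... | old x _ | old y _ | old z q =
    avoids G' x y z (outside-reflects b i<j) (outside-reflects b j<k) q
      (old-reflects y x s) (old-reflects z y t)

  code-added : ∀ w → w 0 ≡ U → w (suc b) ≡ D → code g' ≈[ b + r ] (w ∘ outside b) → code g ≈[ N ] w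
  code-added w w0 wa E j p with position j p
  ... | first   = sym w0
  ... | partner = trans (cong (letter (suc b)) (addArc-partner b g')) (sym wa)
  ... | old y q = trans (cong (letter (outside b y)) (addArc-outside b g' y))
                    (trans (letter-embed (outside b) (outside-mono b) y (g' y)) (E y q))

-- A path U w₁ … with first down step at position b + 1 is realised by
-- adding the arc (0, b + 1) to a realisation of the word read along
-- outside b, which is a path by Path-drop-ups / Path-add-ups.
realise-arc : ∀ {n} b r w → suc (b + r) ≡ n → w 0 ≡ U → w (suc b) ≡ D →
              (∀ j → j < b → w (suc j) ≡ U) → Path 1 n (w ∘ suc) →
              (∀ w' → Path 0 (b + r) w' → Realised (b + r) w') → Realised (suc n) w
realise-arc b r w refl w0 wa inner p induction =
  AddArc.g b r g' G' opens , AddArc.added b r g' G' opens , AddArc.code-added b r g' G' opens w w0 wa E'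
  where
  w' : Word
  w' = w ∘ outside b

  rest-matches : ∀ i → i < r → w (suc (b + suc i)) ≡ w' (b + i)
  rest-matches i _ = cong (w ∘ suc) (trans (+-suc b i) (sym (skip-≥ b (b + i) (m≤m+n b i))))

  inner' : ∀ j → j < b → w' j ≡ U
  inner' j q = trans (cong (w ∘ suc) (skip-< b j q)) (inner j q)

  w'-Path : Path 0 (b + r) w'
  w'-Path = Path-add-ups b 0 r w' inner'
    (Path-cong b r _ _ rest-matches
      (Path-uncons (suc b) r (λ i → w (suc (b + i))) D (trans (cong (w ∘ suc) (+-identityʳ b)) wa)
        (Path-drop-ups b 1 (suc r) (w ∘ suc) inner
          (subst (λ x → Path 1 x (w ∘ suc)) (sym (+-suc b r)) p))))

  g' : ℕ → ℕ
  g' = proj₁ (induction w' w'-Path)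

  G' : Inv321 (b + r) g'
  G' = proj₁ (proj₂ (induction w' w'-Path))

  E' : code g' ≈[ b + r ] w'
  E' = proj₂ (proj₂ (induction w' w'-Path))

  opens : ∀ x → x < b → x < g' x
  opens x q = letter-U x (g' x) (trans (E' x (<-≤-trans q (m≤m+n b r))) (inner' x q))

realise : ∀ n w → Path 0 n w → Realised n w
realise = <-rec (λ n → ∀ w → Path 0 n w → Realised n w) step
  where
  step : ∀ n → (∀ {m} → m < n → ∀ w → Path 0 m w → Realised m w) → ∀ w → Path 0 n w → Realised n w
  step zero    _         w _ = (λ i → i) , empty-Inv321 , λ i ()
  step (suc n) induction w p = after (w 0) refl (Path-uncons 0 n w (w 0) refl p)
    where
    after : ∀ x → w 0 ≡ x → PathAfter 0 x n (w ∘ suc) → Realised (suc n) w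
    after F w0 (_ , p') with induction ≤-refl (w ∘ suc) p'
    ... | g' , G' , E' =
      addFixed g' , addFixed-Inv321 n g' G' , λ { zero _ → sym w0 ; (suc i) (s≤s q) → E' i q }
    after U w0 p' with first-down 0 n (w ∘ suc) p'
    ... | b , b<n , down , inner =
      realise-arc b (n ∸ suc b) w split w0 down inner p'
        (induction (s≤s (≤-trans (n≤1+n _) (≤-reflexive split))))
      where
      split : suc (b + (n ∸ suc b)) ≡ n
      split = m+[n∸m]≡n b<n

≈-sym : ∀ {n w w'} → w ≈[ n ] w' → w' ≈[ n ] w
≈-sym E i p = sym (E i p)

≈-trans : ∀ {n w w' w''} → w ≈[ n ] w' → w' ≈[ n ] w'' → w ≈[ n ] w''
≈-trans E E' i p = trans (E i p) (E' i p)

-- Maps on Fin N viewed as maps on ℕ (the identity beyond N) and back.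
toℕ-map : ∀ {N} → (Fin N → Fin N) → ℕ → ℕ
toℕ-map {N} π i with i <? N
... | yes i<N = toℕ (π (fromℕ< i<N))
... | no _    = i

toℕ-map-< : ∀ {N} (π : Fin N → Fin N) i (i<N : i < N) → toℕ-map π i ≡ toℕ (π (fromℕ< i<N))
toℕ-map-< {N} π i i<N with i <? N
... | yes _  = refl
... | no i≮N = ⊥-elim (i≮N i<N)

toℕ-map-toℕ : ∀ {N} (π : Fin N → Fin N) (i : Fin N) → toℕ-map π (toℕ i) ≡ toℕ (π i)
toℕ-map-toℕ π i = trans (toℕ-map-< π (toℕ i) (toℕ<n i)) (cong (toℕ ∘ π) (fromℕ<-toℕ i (toℕ<n i)))

toℕ-map-Inv321 : ∀ {N} (π : Fin N → Fin N) → IsInvolution π → Avoids321 π → Inv321 N (toℕ-map π)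
bounded (toℕ-map-Inv321 π I A) i i<N = subst (_< _) (sym (toℕ-map-< π i i<N)) (toℕ<n _)
involutive (toℕ-map-Inv321 π I A) i i<N = begin
    toℕ-map π (toℕ-map π i)           ≡⟨ cong (toℕ-map π) (toℕ-map-< π i i<N) ⟩
    toℕ-map π (toℕ (π (fromℕ< i<N)))  ≡⟨ toℕ-map-toℕ π (π (fromℕ< i<N)) ⟩
    toℕ (π (π (fromℕ< i<N)))          ≡⟨ cong toℕ (I (fromℕ< i<N)) ⟩
    toℕ (fromℕ< i<N)                  ≡⟨ toℕ-fromℕ< i<N ⟩
    i                                 ∎
  where open ≡-Reasoning
avoids (toℕ-map-Inv321 π I A) i j k i<j j<k k<N s t =
  A (fromℕ< i<N) (fromℕ< j<N) (fromℕ< k<N)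
    (subst₂ _<_ (sym (toℕ-fromℕ< i<N)) (sym (toℕ-fromℕ< j<N)) i<j)
    (subst₂ _<_ (sym (toℕ-fromℕ< j<N)) (sym (toℕ-fromℕ< k<N)) j<k)
    ( subst₂ _<_ (toℕ-map-< π j j<N) (toℕ-map-< π i i<N) s
    , subst₂ _<_ (toℕ-map-< π k k<N) (toℕ-map-< π j j<N) t)
  where
  j<N : j < _
  j<N = <-trans j<k k<N
  i<N : i < _
  i<N = <-trans i<j j<N

fromℕ-map : ∀ {N g} → Inv321 N g → Fin N → Fin N
fromℕ-map {g = g} G i = fromℕ< (bounded G (toℕ i) (toℕ<n i))

fromℕ-map-toℕ : ∀ {N g} (G : Inv321 N g) i → toℕ (fromℕ-map G i) ≡ g (toℕ i)
fromℕ-map-toℕ G i = toℕ-fromℕ< (bounded G (toℕ i) (toℕ<n i))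

fromℕ-map-involution : ∀ {N g} (G : Inv321 N g) → IsInvolution (fromℕ-map G)
fromℕ-map-involution {g = g} G i = toℕ-injective (begin
    toℕ (fromℕ-map G (fromℕ-map G i))  ≡⟨ fromℕ-map-toℕ G _ ⟩
    g (toℕ (fromℕ-map G i))            ≡⟨ cong g (fromℕ-map-toℕ G i) ⟩
    g (g (toℕ i))                      ≡⟨ involutive G (toℕ i) (toℕ<n i) ⟩
    toℕ i                              ∎)
  where open ≡-Reasoning

fromℕ-map-avoids : ∀ {N g} (G : Inv321 N g) → Avoids321 (fromℕ-map G)
fromℕ-map-avoids G i j k i<j j<k (s , t) = avoids G (toℕ i) (toℕ j) (toℕ k) i<j j<k (toℕ<n k)
  (subst₂ _<_ (fromℕ-map-toℕ G j) (fromℕ-map-toℕ G i) s)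
  (subst₂ _<_ (fromℕ-map-toℕ G k) (fromℕ-map-toℕ G j) t)

toℕ-map-fromℕ-map : ∀ {N g} (G : Inv321 N g) i → i < N → toℕ-map (fromℕ-map G) i ≡ g i
toℕ-map-fromℕ-map {g = g} G i i<N =
  trans (toℕ-map-< _ i i<N) (trans (fromℕ-map-toℕ G (fromℕ< i<N)) (cong g (toℕ-fromℕ< i<N)))

module WordOf (n : ℕ) (P : (Fin (suc n) → Fin (suc n)) → Set) where
  N : ℕ
  N = suc n

  open Setoid (I321Setoid N P) using (Carrier; _≈_) public

  word : (Fin N → Fin N) → Word
  word π = code (toℕ-map π)

  word-head : ∀ π → word π 0 ≡ letter 0 (toℕ (π fzero))
  word-head π = cong (letter 0) (toℕ-map-toℕ π fzero)

  fixes⇒F : ∀ π → π fzero ≡ fzero → word π 0 ≡ F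
  fixes⇒F π fixes = trans (word-head π) (cong (letter 0 ∘ toℕ) fixes)

  moves⇒U : ∀ π → ¬ π fzero ≡ fzero → word π 0 ≡ U
  moves⇒U π moves = trans (word-head π) (letter-< 0 _ (n≢0⇒n>0 (moves ∘ toℕ-injective)))

  F⇒fixes : ∀ π → word π 0 ≡ F → π fzero ≡ fzero
  F⇒fixes π e = toℕ-injective (letter-F 0 _ (trans (sym (word-head π)) e))

  U⇒moves : ∀ π → word π 0 ≡ U → ¬ π fzero ≡ fzero
  U⇒moves π e fixes with trans (sym e) (fixes⇒F π fixes)
  ... | ()

  wordOf : Carrier → Word
  wordOf x = word (proj₁ x)

  wordOf-Path : ∀ x → Path 0 N (wordOf x)
  wordOf-Path (π , I , A , _) = code-Path N (toℕ-map π) (toℕ-map-Inv321 π I A)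

  wordOf-injective : ∀ x y → wordOf x ≈[ N ] wordOf y → x ≈ y
  wordOf-injective (π , Iπ , Aπ , _) (σ , Iσ , Aσ , _) E i = toℕ-injective (begin
      toℕ (π i)          ≡⟨ sym (toℕ-map-toℕ π i) ⟩
      toℕ-map π (toℕ i)  ≡⟨ code-injective (toℕ-map-Inv321 π Iπ Aπ) (toℕ-map-Inv321 σ Iσ Aσ) E
                                              (toℕ i) (toℕ<n i) ⟩
      toℕ-map σ (toℕ i)  ≡⟨ toℕ-map-toℕ σ i ⟩
      toℕ (σ i)          ∎)
    where open ≡-Reasoning

  wordOf-cong : ∀ x y → x ≈ y → wordOf x ≈[ N ] wordOf y
  wordOf-cong (π , _) (σ , _) E i i<N =
    cong (letter i) (trans (toℕ-map-< π i i<N) (trans (cong toℕ (E _)) (sym (toℕ-map-< σ i i<N))))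

  realiseIn : ∀ w → Path 0 N w → (∀ π → word π ≈[ N ] w → P π) →
              Σ Carrier λ x → wordOf x ≈[ N ] w
  realiseIn w p inP with realise N w p
  ... | g , G , E = (π , fromℕ-map-involution G , fromℕ-map-avoids G , inP π E') , E'
    where
    π  = fromℕ-map G
    E' : word π ≈[ N ] w
    E' i i<N = trans (cong (letter i) (toℕ-map-fromℕ-map G i i<N)) (E i i<N)

module PathBijection (n : ℕ) (odd : Odd n) where
  N : ℕ
  N = suc n

  toFixed : Word → Word
  toFixed w = F ◂ flattenReturn 1 n (w ∘ suc)

  toMoving : Word → Word
  toMoving w = U ◂ closeFlat n (w ∘ suc)

  odd' : Odd (n + 0)
  odd' = subst Odd (sym (+-identityʳ n)) odd

  toFixed-Path : ∀ w → Path 0 N w → w 0 ≡ U → Path 0 N (toFixed w)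
  toFixed-Path w p w0 = refl , flattenReturn-Path n 0 (w ∘ suc) (Path-uncons 0 n w U w0 p)

  toMoving-Path : ∀ w → Path 0 N w → w 0 ≡ F → Path 0 N (toMoving w)
  toMoving-Path w p w0 = closeFlat-Path n 0 (w ∘ suc) (proj₂ (Path-uncons 0 n w F w0 p)) odd'

  toMoving-toFixed : ∀ w → Path 0 N w → w 0 ≡ U → toMoving (toFixed w) ≈[ N ] w
  toMoving-toFixed w p w0 zero    _       = sym w0
  toMoving-toFixed w p w0 (suc i) (s≤s q) =
    closeFlat-flattenReturn n 0 (w ∘ suc) (Path-uncons 0 n w U w0 p) i q

  toFixed-toMoving : ∀ w → Path 0 N w → w 0 ≡ F → toFixed (toMoving w) ≈[ N ] w
  toFixed-toMoving w p w0 zero    _       = sym w0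
  toFixed-toMoving w p w0 (suc i) (s≤s q) =
    flattenReturn-closeFlat n 0 (w ∘ suc) (proj₂ (Path-uncons 0 n w F w0 p)) odd' i q

  toFixed-cong : ∀ {w w'} → w ≈[ N ] w' → toFixed w ≈[ N ] toFixed w'
  toFixed-cong E zero    _       = refl
  toFixed-cong E (suc i) (s≤s q) = flattenReturn-cong 1 n _ _ (≈-tail E) i q

  toMoving-cong : ∀ {w w'} → w ≈[ N ] w' → toMoving w ≈[ N ] toMoving w'
  toMoving-cong E zero    _       = refl
  toMoving-cong E (suc i) (s≤s q) = closeFlat-cong n _ _ (≈-tail E) i q

module Involutions (n : ℕ) (odd : Odd n) where
  open PathBijection n odd
  module Moving = WordOf n (λ π → ¬ π fzero ≡ fzero)
  module Fixed  = WordOf n (λ π → π fzero ≡ fzero)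

  toFixedIn : (x : Moving.Carrier) → Σ Fixed.Carrier λ y → Fixed.wordOf y ≈[ N ] toFixed (Moving.wordOf x)
  toFixedIn x@(π , _ , _ , moves) =
    Fixed.realiseIn (toFixed (Moving.wordOf x))
      (toFixed-Path (Moving.wordOf x) (Moving.wordOf-Path x) (Moving.moves⇒U π moves))
      (λ σ E → Fixed.F⇒fixes σ (E 0 (s≤s z≤n)))

  toMovingIn : (y : Fixed.Carrier) → Σ Moving.Carrier λ x → Moving.wordOf x ≈[ N ] toMoving (Fixed.wordOf y)
  toMovingIn y@(σ , _ , _ , fixes) =
    Moving.realiseIn (toMoving (Fixed.wordOf y))
      (toMoving-Path (Fixed.wordOf y) (Fixed.wordOf-Path y) (Fixed.fixes⇒F σ fixes))
      (λ π E → Moving.U⇒moves π (E 0 (s≤s z≤n)))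

  toFixedIn-word : ∀ x → Fixed.wordOf (proj₁ (toFixedIn x)) ≈[ N ] toFixed (Moving.wordOf x)
  toFixedIn-word x = proj₂ (toFixedIn x)

  toMovingIn-word : ∀ y → Moving.wordOf (proj₁ (toMovingIn y)) ≈[ N ] toMoving (Fixed.wordOf y)
  toMovingIn-word y = proj₂ (toMovingIn y)

  toFixed-toMoving-word : (y : Fixed.Carrier) → toFixed (toMoving (Fixed.wordOf y)) ≈[ N ] Fixed.wordOf y
  toFixed-toMoving-word y@(σ , _ , _ , fixes) =
    toFixed-toMoving (Fixed.wordOf y) (Fixed.wordOf-Path y) (Fixed.fixes⇒F σ fixes)

  toMoving-toFixed-word : (x : Moving.Carrier) → toMoving (toFixed (Moving.wordOf x)) ≈[ N ] Moving.wordOf x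
  toMoving-toFixed-word x@(π , _ , _ , moves) =
    toMoving-toFixed (Moving.wordOf x) (Moving.wordOf-Path x) (Moving.moves⇒U π moves)

  to : Moving.Carrier → Fixed.Carrier
  to x = proj₁ (toFixedIn x)

  from : Fixed.Carrier → Moving.Carrier
  from y = proj₁ (toMovingIn y)

  -- Every equation between elements is checked on their words.
  to-cong : ∀ x x' → x Moving.≈ x' → to x Fixed.≈ to x'
  to-cong x x' E = Fixed.wordOf-injective (to x) (to x')
    (≈-trans (toFixedIn-word x)
    (≈-trans (toFixed-cong (Moving.wordOf-cong x x' E))
             (≈-sym (toFixedIn-word x'))))

  from-cong : ∀ y y' → y Fixed.≈ y' → from y Moving.≈ from y'
  from-cong y y' E = Moving.wordOf-injective (from y) (from y')
    (≈-trans (toMovingIn-word y)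
    (≈-trans (toMoving-cong (Fixed.wordOf-cong y y' E))
             (≈-sym (toMovingIn-word y'))))

  to-from : ∀ y x → x Moving.≈ from y → to x Fixed.≈ y
  to-from y x E = Fixed.wordOf-injective (to x) y
    (≈-trans (toFixedIn-word x)
    (≈-trans (toFixed-cong (≈-trans (Moving.wordOf-cong x (from y) E) (toMovingIn-word y)))
             (toFixed-toMoving-word y)))

  from-to : ∀ x y → y Fixed.≈ to x → from y Moving.≈ x
  from-to x y E = Moving.wordOf-injective (from y) x
    (≈-trans (toMovingIn-word y)
    (≈-trans (toMoving-cong (≈-trans (Fixed.wordOf-cong y (to x) E) (toFixedIn-word x)))
             (toMoving-toFixed-word x)))

  inverse : Inverse (I321-moves1 n) (I321-fixes1 n)
  inverse = record
    { to        = to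
    ; from      = from
    ; to-cong   = λ {x} {x'} → to-cong x x'
    ; from-cong = λ {y} {y'} → from-cong y y'
    ; inverse   = (λ {y} {x} → to-from y x) , (λ {x} {y} → from-to x y)
    }

odd-double : ∀ k → Odd (suc (k + k))
odd-double zero    = one
odd-double (suc k) = subst (λ m → Odd (suc (suc m))) (sym (+-suc k k)) (plusTwo (odd-double k))

-- For m = k + 1 the length 2m = (2m - 1) + 1 and 2m - 1 is odd.
lemma3p4 : (m : ℕ) → m ≥ 1 → Bijection (I321-moves1 (2 * m ∸ 1)) (I321-fixes1 (2 * m ∸ 1))
lemma3p4 (suc k) _ = Inverse⇒Bijection (Involutions.inverse (2 * suc k ∸ 1) odd)
  where
  odd : Odd (2 * suc k ∸ 1)
  odd = subst Odd (trans (sym (+-suc k k)) (cong (k +_) (cong suc (sym (+-identityʳ k))))) (odd-double k)
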